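{- Let $G$ be a finite simple graph on $n\ge 1$ vertices. If $\delta(G)\ge n-3$, then $oh(G)\ge \lceil n/\alpha(G)\rceil$.
   Context: $\delta(G)$ is the minimum degree and $\alpha(G)$ the independence number of $G$. A $K_t$-expansion in $G$ consists of $t$ vertex-disjoint trees in $G$, every two of which are joined by an edge of $G$; it is odd if its vertices can be two-colored so that tree edges are bichromatic but the edges joining different trees are monochromatic. $oh(G)$ is the largest $t$ such that $G$ contains an odd $K_t$-expansion (odd $K_t$ minor). -}

module Defs where

open import Data.Nat using (ℕ; zero; suc; _+_; _∸_; _≤_; _/_)
open import Data.Bool using (Bool; true; false)
open import Data.Fin using (Fin)
open import Data.Fin.Subset using (Subset; _∈_; ∣_∣)
open import Data.Vec using (tabulate)
open import Data.Maybe using (Maybe; just)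
open import Data.List using (List; []; _∷_; _++_; length)
open import Data.List.Relation.Unary.Unique.Propositional using (Unique)
open import Data.Product using (Σ; ∃; _×_)
open import Data.Empty using (⊥)
open import Relation.Nullary using (¬_)
open import Relation.Binary.PropositionalEquality using (_≡_)

record Graph (n : ℕ) : Set where
  field
    adj    : Fin n → Fin n → Bool
    sym    : ∀ u v → adj u v ≡ adj v u
    irrefl : ∀ v → adj v v ≡ false
open Graph public

N : ∀ {n} → Graph n → Fin n → Subset n
N G v = tabulate (adj G v)

deg : ∀ {n} → Graph n → Fin n → ℕ
deg G v = ∣ N G v ∣

MinDegreeAtLeast : ∀ {n} → Graph n → ℕ → Set
MinDegreeAtLeast G d = ∀ v → d ≤ deg G v

Independent : ∀ {n} → Graph n → Subset n → Set
Independent G S = ∀ u v → u ∈ S → v ∈ S → adj G u v ≡ false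

IsIndependenceNumber : ∀ {n} → Graph n → ℕ → Set
IsIndependenceNumber {n} G k =
  (Σ (Subset n) λ S → Independent G S × ∣ S ∣ ≡ k)
  × (∀ (S : Subset n) → Independent G S → ∣ S ∣ ≤ k)

-- ⌈ n / k ⌉ (with the junk value 0 for k = 0)
ceilDiv : ℕ → ℕ → ℕ
ceilDiv n zero    = 0
ceilDiv n (suc k) = (n + k) / suc k

data Reach {n : ℕ} (E : Fin n → Fin n → Bool) : Fin n → Fin n → Set where
  here : ∀ {u} → Reach E u u
  step : ∀ {u v w} → E u v ≡ true → Reach E v w → Reach E u w

Consec : ∀ {n} → (Fin n → Fin n → Bool) → List (Fin n) → Set
Consec E []           = Data.Unit.⊤ where import Data.Unit
Consec E (x ∷ [])     = Data.Unit.⊤ where import Data.Unit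
Consec E (x ∷ y ∷ xs) = (E x y ≡ true) × Consec E (y ∷ xs)

Acyclic : ∀ {n} → (Fin n → Fin n → Bool) → Set
Acyclic {n} E = ∀ (x : Fin n) (ys : List (Fin n)) → 2 ≤ length ys
  → Unique (x ∷ ys) → Consec E (x ∷ ys ++ x ∷ []) → ⊥

-- An odd K_t-expansion in G.
--   branch v = just i  : v lies in the i-th tree;  nothing : v unused
--   tree               : the tree edges (symmetric, edges of G, inside one
--                        branch set); together they form a forest whose
--                        components are exactly the branch sets (each
--                        branch set nonempty and connected by tree edges)
--   colour             : the two-colouring; tree edges bichromatic
--   for i ≠ j some edge of G joins tree i and tree j, and it is
--   monochromatic.
record OddExpansion {n : ℕ} (G : Graph n) (t : ℕ) : Set where
  field
    branch   : Fin n → Maybe (Fin t)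
    tree     : Fin n → Fin n → Bool
    colour   : Fin n → Bool
    treeSym  : ∀ u v → tree u v ≡ tree v u
    treeAdj  : ∀ u v → tree u v ≡ true → adj G u v ≡ true
    treeIn   : ∀ u v → tree u v ≡ true →
                 Σ (Fin t) λ i → branch u ≡ just i × branch v ≡ just i
    acyclic  : Acyclic tree
    nonempty : ∀ (i : Fin t) → ∃ λ v → branch v ≡ just i
    connected : ∀ (i : Fin t) u v → branch u ≡ just i → branch v ≡ just i
                 → Reach tree u v
    bichrom  : ∀ u v → tree u v ≡ true → ¬ (colour u ≡ colour v)
    joined   : ∀ (i j : Fin t) → ¬ (i ≡ j) →
                 ∃ λ u → ∃ λ v → branch u ≡ just i × branch v ≡ just j
                   × adj G u v ≡ true × colour u ≡ colour v

OhAtLeast : ∀ {n} → Graph n → ℕ → Set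
OhAtLeast G m = ∃ λ t → m ≤ t × OddExpansion G t

-- Since δ(G) ≥ n − 3, every vertex has at most two non-neighbours. The expansion is
-- built greedily from branch sets that are a single vertex (a hub) or an edge from a
-- hub to a leaf, hubs coloured true and leaves false. The set R of unused vertices is
-- kept adjacent to every hub chosen so far, so a new branch set inside R is joined to
-- each earlier one by a monochromatic hub–hub edge. Every round adds k ∈ {1, 2} branch
-- sets and uses up at most kα vertices of R: a vertex h whose non-neighbours in R are
-- independent uses up exactly h and those; otherwise there are four vertices with the
-- non-edges vu, vw, ux (so α ≥ 2) which yield two branch sets. When R is empty, n ≤ α t.

module Submission where

open import Defs hiding (sym)
open import Data.Nat using (ℕ; zero; suc; _+_; _*_; _∸_; _≤_; _<_; z≤n; s≤s; s≤s⁻¹)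
open import Data.Nat.Properties
open import Data.Bool using (Bool; true; false)
open import Data.Bool.Properties using (¬-not)
open import Data.Fin using (Fin; zero; suc)
open import Data.Fin.Properties using (any?) renaming (_≟_ to _≟ᶠ_)
open import Data.Fin.Subset using (Subset; inside; outside; _∈_; _∉_; _⊆_; _∩_; _∪_; _-_; ∁; ⁅_⁆; ⊤; ∣_∣)
open import Data.Fin.Subset.Properties
open import Data.Vec using ([]; _∷_)
open import Data.Vec.Properties using (lookup∘tabulate; []=⇒lookup; lookup⇒[]=)
open import Data.Maybe using (Maybe; just; nothing; maybe)
open import Data.List using (List; []; _∷_; _++_; length; lookup)
open import Data.List.Properties using (length-++)
open import Data.List.Membership.Propositional.Properties using (∈-lookup)
open import Data.List.Relation.Unary.All as All using (All; []; _∷_)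
open import Data.List.Relation.Unary.AllPairs using (AllPairs; []; _∷_)
import Data.List.Relation.Unary.AllPairs.Properties as AllPairs
import Data.List.Relation.Unary.All.Properties as All
open import Data.List.Relation.Unary.Unique.Propositional using (Unique)
open import Data.Product using (∃; ∃₂; _×_; _,_; proj₁; proj₂)
open import Data.Sum as Sum using (_⊎_; inj₁; inj₂)
open import Data.Empty using (⊥-elim)
open import Relation.Nullary using (Dec; does; yes; no)
open import Relation.Nullary.Decidable using (_×-dec_; _⊎-dec_; ¬?; dec-true; dec-false; does-⇔)
open import Relation.Binary.Definitions using (Symmetric)
open import Function using (_∘_; _on_; mk⇔)
open import Induction.WellFounded using (Acc; acc)
import Relation.Binary.Construct.On as On
open import Data.Nat.Induction using (<-wellFounded)
open import Data.Nat.DivMod using (m<n*o⇒m/o<n)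
open import Relation.Binary.PropositionalEquality


∣p∣≡∣p∩q∣+∣p∩∁q∣ : ∀ {n} (p q : Subset n) → ∣ p ∣ ≡ ∣ p ∩ q ∣ + ∣ p ∩ ∁ q ∣
∣p∣≡∣p∩q∣+∣p∩∁q∣ [] [] = refl
∣p∣≡∣p∩q∣+∣p∩∁q∣ (inside ∷ p) (inside ∷ q) = cong suc (∣p∣≡∣p∩q∣+∣p∩∁q∣ p q)
∣p∣≡∣p∩q∣+∣p∩∁q∣ (inside ∷ p) (outside ∷ q) =
  trans (cong suc (∣p∣≡∣p∩q∣+∣p∩∁q∣ p q)) (sym (+-suc _ _))
∣p∣≡∣p∩q∣+∣p∩∁q∣ (outside ∷ p) (_ ∷ q) = ∣p∣≡∣p∩q∣+∣p∩∁q∣ p q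

x∉p⇒x∉p∩q : ∀ {n} {x : Fin n} {p q : Subset n} → x ∉ p → x ∉ p ∩ q
x∉p⇒x∉p∩q {p = p} {q} x∉p = x∉p ∘ p∩q⊆p p q

x∉q⇒x∉p∩q : ∀ {n} {x : Fin n} {p q : Subset n} → x ∉ q → x ∉ p ∩ q
x∉q⇒x∉p∩q {p = p} {q} x∉q = x∉q ∘ p∩q⊆q p q

x∈p∩∁q⁻ : ∀ {n} {x : Fin n} (p q : Subset n) → x ∈ p ∩ ∁ q → x ∈ p × x ∉ q
x∈p∩∁q⁻ p q x∈ = let x∈p , x∈∁q = x∈p∩q⁻ p (∁ q) x∈ in x∈p , x∈∁p⇒x∉p x∈∁q

length≤∣p∣ : ∀ {n} {xs : List (Fin n)} {p : Subset n} →
             Unique xs → All (_∈ p) xs → length xs ≤ ∣ p ∣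
length≤∣p∣ [] [] = z≤n
length≤∣p∣ {xs = x ∷ xs} {p} (x≢xs ∷ xs!) (x∈p ∷ xs⊆p) =
  ≤-trans (s≤s (length≤∣p∣ xs! xs⊆p-x)) (x∈p⇒∣p-x∣<∣p∣ x∈p)
  where
  xs⊆p-x : All (_∈ p - x) xs
  xs⊆p-x = All.zipWith (λ (y∈p , x≢y) → x∈p∧x≢y⇒x∈p-y y∈p (x≢y ∘ sym)) (xs⊆p , x≢xs)

does≡true⇒ : ∀ {p} {P : Set p} (p? : Dec P) → does p? ≡ true → P
does≡true⇒ (yes p) _ = p

AllPairs-lookup : ∀ {a ℓ} {A : Set a} {R : A → A → Set ℓ} → Symmetric R →
                  ∀ {xs} → AllPairs R xs → ∀ {i j} → i ≢ j → R (lookup xs i) (lookup xs j)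
AllPairs-lookup R-sym (_ ∷ _)   {zero}  {zero}  i≢j = ⊥-elim (i≢j refl)
AllPairs-lookup R-sym (Rx ∷ _)  {zero}  {suc j} _   = All.lookup Rx (∈-lookup j)
AllPairs-lookup R-sym (Rx ∷ _)  {suc i} {zero}  _   = R-sym (All.lookup Rx (∈-lookup i))
AllPairs-lookup R-sym (_ ∷ Rxs) {suc i} {suc j} i≢j = AllPairs-lookup R-sym Rxs (i≢j ∘ cong suc)

module Adjacency {n : ℕ} (G : Graph n) where

  ∈N⁺ : ∀ {u v} → adj G v u ≡ true → u ∈ N G v
  ∈N⁺ {u} {v} e = lookup⇒[]= u (N G v) (trans (lookup∘tabulate (adj G v) u) e)

  ∈N⁻ : ∀ {u v} → u ∈ N G v → adj G v u ≡ true
  ∈N⁻ {u} {v} u∈ = trans (sym (lookup∘tabulate (adj G v) u)) ([]=⇒lookup u∈)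

  ∉N⁻ : ∀ {u v} → u ∉ N G v → adj G v u ≡ false
  ∉N⁻ u∉ = ¬-not (u∉ ∘ ∈N⁺)

  ∈N-sym : ∀ {u v} → u ∈ N G v → v ∈ N G u
  ∈N-sym {u} {v} u∈ = ∈N⁺ (trans (Graph.sym G u v) (∈N⁻ u∈))

  self∉N : ∀ {v} → v ∉ N G v
  self∉N {v} v∈ with trans (sym (∈N⁻ v∈)) (irrefl G v)
  ... | ()

  ∈N⇒≢ : ∀ {u v} → u ∈ N G v → u ≢ v
  ∈N⇒≢ u∈ refl = self∉N u∈

  independent-or-edge : ∀ S → Independent G S ⊎ ∃₂ λ u w → u ∈ S × w ∈ S × w ∈ N G u
  independent-or-edge S
    with any? (λ u → any? (λ w → (u ∈? S) ×-dec (w ∈? S) ×-dec (w ∈? N G u)))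
  ... | yes (u , w , edge) = inj₂ (u , w , edge)
  ... | no no-edge = inj₁ λ u w u∈S w∈S → ∉N⁻ λ w∈Nu → no-edge (u , w , u∈S , w∈S , w∈Nu)

module CoDegree {n : ℕ} (G : Graph n) (δ≥n∸3 : MinDegreeAtLeast G (n ∸ 3)) where

  open Adjacency G

  ∣∁N∣≤3 : ∀ v → ∣ ∁ (N G v) ∣ ≤ 3
  ∣∁N∣≤3 v = begin
    ∣ ∁ (N G v) ∣ ≡⟨ ∣∁p∣≡n∸∣p∣ (N G v) ⟩
    n ∸ deg G v   ≤⟨ m≤n+o⇒m∸n≤o n (deg G v) n≤deg+3 ⟩
    3             ∎
    where
    open ≤-Reasoning
    n≤deg+3 : n ≤ deg G v + 3
    n≤deg+3 = begin
      n               ≤⟨ m≤n+m∸n n 3 ⟩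
      3 + (n ∸ 3)     ≤⟨ +-monoʳ-≤ 3 (δ≥n∸3 v) ⟩
      3 + deg G v     ≡⟨ +-comm 3 (deg G v) ⟩
      deg G v + 3     ∎

  nonNeighbour-cases : ∀ {u v w r} → u ∉ N G v → w ∉ N G v → w ∈ N G u → r ∉ N G v
                       → r ≡ v ⊎ r ≡ u ⊎ r ≡ w
  nonNeighbour-cases {u} {v} {w} {r} u∉ w∉ w∈Nu r∉ with r ≟ᶠ v | r ≟ᶠ u | r ≟ᶠ w
  ... | yes r≡v | _       | _       = inj₁ r≡v
  ... | no _    | yes r≡u | _       = inj₂ (inj₁ r≡u)
  ... | no _    | no _    | yes r≡w = inj₂ (inj₂ r≡w)
  ... | no r≢v  | no r≢u  | no r≢w  = ⊥-elim (<⇒≱ (s≤s (∣∁N∣≤3 v)) four≤)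
    where
    u≢v : u ≢ v
    u≢v refl = w∉ w∈Nu
    w≢v : w ≢ v
    w≢v refl = u∉ (∈N-sym w∈Nu)
    four≤ : 4 ≤ ∣ ∁ (N G v) ∣
    four≤ = length≤∣p∣ {xs = v ∷ u ∷ w ∷ r ∷ []}
      ( (u≢v ∘ sym ∷ w≢v ∘ sym ∷ r≢v ∘ sym ∷ [])
      ∷ (∈N⇒≢ w∈Nu ∘ sym ∷ r≢u ∘ sym ∷ [])
      ∷ (r≢w ∘ sym ∷ [])
      ∷ [] ∷ [])
      (x∉p⇒x∈∁p self∉N ∷ x∉p⇒x∈∁p u∉ ∷ x∉p⇒x∈∁p w∉ ∷ x∉p⇒x∈∁p r∉ ∷ [])

module Branches {n : ℕ} (G : Graph n) where

  open Adjacency G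

  data Branch : Set where
    vertex : Fin n → Branch
    edge   : (h l : Fin n) → l ∈ N G h → Branch

  hub : Branch → Fin n
  hub (vertex h)   = h
  hub (edge h _ _) = h

  infix 4 _∈ᵇ_ _∈ᵇ?_

  _∈ᵇ_ : Fin n → Branch → Set
  v ∈ᵇ vertex h   = v ≡ h
  v ∈ᵇ edge h l _ = v ≡ h ⊎ v ≡ l

  _∈ᵇ?_ : ∀ v B → Dec (v ∈ᵇ B)
  v ∈ᵇ? vertex h   = v ≟ᶠ h
  v ∈ᵇ? edge h l _ = v ≟ᶠ h ⊎-dec v ≟ᶠ l

  hub∈ᵇ : ∀ B → hub B ∈ᵇ B
  hub∈ᵇ (vertex h)   = refl
  hub∈ᵇ (edge h l _) = inj₁ refl

  data Allᵇ (P : Fin n → Set) : Branch → Set where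
    vertex : ∀ {h} → P h → Allᵇ P (vertex h)
    edge   : ∀ {h l e} → P h → P l → Allᵇ P (edge h l e)

  module _ {P : Fin n → Set} where

    allᵇ-∈ : ∀ {B v} → Allᵇ P B → v ∈ᵇ B → P v
    allᵇ-∈ (vertex Ph)  refl        = Ph
    allᵇ-∈ (edge Ph Pl) (inj₁ refl) = Ph
    allᵇ-∈ (edge Ph Pl) (inj₂ refl) = Pl

    allᵇ-intro : ∀ {B} → (∀ {v} → v ∈ᵇ B → P v) → Allᵇ P B
    allᵇ-intro {vertex h}   P∈ = vertex (P∈ refl)
    allᵇ-intro {edge h l _} P∈ = edge (P∈ (inj₁ refl)) (P∈ (inj₂ refl))

    allᵇ-map : ∀ {Q : Fin n → Set} {B} → (∀ {v} → P v → Q v) → Allᵇ P B → Allᵇ Q B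
    allᵇ-map f (vertex Ph)  = vertex (f Ph)
    allᵇ-map f (edge Ph Pl) = edge (f Ph) (f Pl)

  ∈ᵇ-adjacent : ∀ {B u v} → u ∈ᵇ B → v ∈ᵇ B → u ≢ v → v ∈ N G u
  ∈ᵇ-adjacent {vertex h}   refl        refl        u≢v = ⊥-elim (u≢v refl)
  ∈ᵇ-adjacent {edge h l e} (inj₁ refl) (inj₁ refl) u≢v = ⊥-elim (u≢v refl)
  ∈ᵇ-adjacent {edge h l e} (inj₁ refl) (inj₂ refl) _   = e
  ∈ᵇ-adjacent {edge h l e} (inj₂ refl) (inj₁ refl) _   = ∈N-sym e
  ∈ᵇ-adjacent {edge h l e} (inj₂ refl) (inj₂ refl) u≢v = ⊥-elim (u≢v refl)

  ∈ᵇ-atMostTwo : ∀ {B u v w} → u ∈ᵇ B → v ∈ᵇ B → w ∈ᵇ B → u ≢ v → w ≢ v → u ≡ w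
  ∈ᵇ-atMostTwo {vertex h}   refl        _           refl        _   _   = refl
  ∈ᵇ-atMostTwo {edge h l _} (inj₁ refl) _           (inj₁ refl) _   _   = refl
  ∈ᵇ-atMostTwo {edge h l _} (inj₂ refl) _           (inj₂ refl) _   _   = refl
  ∈ᵇ-atMostTwo {edge h l _} (inj₁ refl) (inj₁ refl) (inj₂ refl) u≢v _   = ⊥-elim (u≢v refl)
  ∈ᵇ-atMostTwo {edge h l _} (inj₁ refl) (inj₂ refl) (inj₂ refl) _   w≢v = ⊥-elim (w≢v refl)
  ∈ᵇ-atMostTwo {edge h l _} (inj₂ refl) (inj₂ refl) (inj₁ refl) u≢v _   = ⊥-elim (u≢v refl)
  ∈ᵇ-atMostTwo {edge h l _} (inj₂ refl) (inj₁ refl) (inj₁ refl) _   w≢v = ⊥-elim (w≢v refl)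

  isHub : Branch → Fin n → Bool
  isHub B v = does (v ≟ᶠ hub B)

  isHub-injective : ∀ {B u v} → u ∈ᵇ B → v ∈ᵇ B → isHub B u ≡ isHub B v → u ≡ v
  isHub-injective {B} {u} {v} u∈B v∈B same with u ≟ᶠ hub B | v ≟ᶠ hub B
  ... | yes u≡hub | yes v≡hub = trans u≡hub (sym v≡hub)
  ... | no u≢hub  | no v≢hub  = ∈ᵇ-atMostTwo u∈B (hub∈ᵇ B) v∈B u≢hub v≢hub
  isHub-injective _ _ () | yes _ | no _
  isHub-injective _ _ () | no _  | yes _

  Disjoint : Branch → Branch → Set
  Disjoint B C = Allᵇ (λ x → Allᵇ (x ≢_) C) B

  Linked : Branch → Branch → Set
  Linked B C = ∃₂ λ x y → x ∈ᵇ B × y ∈ᵇ C × y ∈ N G x × isHub B x ≡ isHub C y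

  Compatible : Branch → Branch → Set
  Compatible B C = Disjoint B C × Linked B C

  compatible-sym : ∀ {B C} → Compatible B C → Compatible C B
  compatible-sym (disjoint , x , y , x∈B , y∈C , y∈Nx , same) =
    allᵇ-intro (λ y∈C → allᵇ-intro (λ x∈B → allᵇ-∈ (allᵇ-∈ disjoint x∈B) y∈C ∘ sym)) ,
    y , x , y∈C , x∈B , ∈N-sym y∈Nx , sym same

  hubs-linked : ∀ {B C} → hub C ∈ N G (hub B) → Linked B C
  hubs-linked {B} {C} adjacent =
    hub B , hub C , hub∈ᵇ B , hub∈ᵇ C , adjacent ,
    trans (dec-true (hub B ≟ᶠ hub B) refl) (sym (dec-true (hub C ≟ᶠ hub C) refl))

  leaves-linked : ∀ {h l h′ l′} (e : l ∈ N G h) (e′ : l′ ∈ N G h′) → l′ ∈ N G l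
                  → Linked (edge h l e) (edge h′ l′ e′)
  leaves-linked e e′ adjacent =
    _ , _ , inj₂ refl , inj₂ refl , adjacent ,
    trans (dec-false (_ ≟ᶠ _) (∈N⇒≢ e)) (sym (dec-false (_ ≟ᶠ _) (∈N⇒≢ e′)))

  module _ (bs : List Branch) (compatible : AllPairs Compatible bs) where

    private
      t : ℕ
      t = length bs

      B : Fin t → Branch
      B = lookup bs

    ∈ᵇ-unique : ∀ {v i j} → v ∈ᵇ B i → v ∈ᵇ B j → i ≡ j
    ∈ᵇ-unique {v} {i} {j} v∈i v∈j with i ≟ᶠ j
    ... | yes i≡j = i≡j
    ... | no i≢j  = ⊥-elim (allᵇ-∈ (allᵇ-∈ disjoint v∈i) v∈j refl)
      where
      disjoint : Disjoint (B i) (B j)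
      disjoint = proj₁ (AllPairs-lookup compatible-sym compatible i≢j)

    branchOf : Fin n → Maybe (Fin t)
    branchOf v with any? (λ i → v ∈ᵇ? B i)
    ... | yes (i , _) = just i
    ... | no _        = nothing

    branchOf-complete : ∀ {v i} → v ∈ᵇ B i → branchOf v ≡ just i
    branchOf-complete {v} {i} v∈i with any? (λ i → v ∈ᵇ? B i)
    ... | yes (j , v∈j) = cong just (∈ᵇ-unique v∈j v∈i)
    ... | no none       = ⊥-elim (none (i , v∈i))

    branchOf-sound : ∀ {v i} → branchOf v ≡ just i → v ∈ᵇ B i
    branchOf-sound {v} eq with any? (λ i → v ∈ᵇ? B i)
    branchOf-sound refl | yes (_ , v∈i) = v∈i

    TreeEdge : Fin n → Fin n → Set
    TreeEdge u v = (∃ λ i → u ∈ᵇ B i × v ∈ᵇ B i) × u ≢ v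

    treeEdge? : ∀ u v → Dec (TreeEdge u v)
    treeEdge? u v = any? (λ i → (u ∈ᵇ? B i) ×-dec (v ∈ᵇ? B i)) ×-dec ¬? (u ≟ᶠ v)

    treeEdge-sym : ∀ {u v} → TreeEdge u v → TreeEdge v u
    treeEdge-sym ((i , u∈ , v∈) , u≢v) = (i , v∈ , u∈) , u≢v ∘ sym

    treeEdge-path : ∀ {u v w} → TreeEdge u v → TreeEdge v w → u ≡ w
    treeEdge-path ((i , u∈ , v∈) , u≢v) ((j , v∈′ , w∈) , v≢w) with ∈ᵇ-unique v∈ v∈′
    ... | refl = ∈ᵇ-atMostTwo u∈ v∈ w∈ u≢v (v≢w ∘ sym)

    tree : Fin n → Fin n → Bool
    tree u v = does (treeEdge? u v)

    tree⁻ : ∀ {u v} → tree u v ≡ true → TreeEdge u v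
    tree⁻ {u} {v} = does≡true⇒ (treeEdge? u v)

    colour : Fin n → Bool
    colour v = maybe (λ i → isHub (B i) v) false (branchOf v)

    colour-∈ᵇ : ∀ {v i} → v ∈ᵇ B i → colour v ≡ isHub (B i) v
    colour-∈ᵇ v∈i rewrite branchOf-complete v∈i = refl

    acyclic : Acyclic tree
    acyclic x (y₁ ∷ y₂ ∷ _) _ ((_ ∷ x≢y₂ ∷ _) ∷ _) (xy₁ , y₁y₂ , _) =
      x≢y₂ (treeEdge-path (tree⁻ xy₁) (tree⁻ y₁y₂))
    acyclic _ (_ ∷ []) (s≤s ())

    connected : ∀ i u v → branchOf u ≡ just i → branchOf v ≡ just i → Reach tree u v
    connected i u v u∈i v∈i with u ≟ᶠ v
    ... | yes refl = here
    ... | no u≢v   = step uv here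
      where
      uv : tree u v ≡ true
      uv = dec-true (treeEdge? u v) ((i , branchOf-sound u∈i , branchOf-sound v∈i) , u≢v)

    bichromatic : ∀ u v → tree u v ≡ true → colour u ≢ colour v
    bichromatic u v uv same =
      let (i , u∈ , v∈) , u≢v = tree⁻ uv
      in u≢v (isHub-injective u∈ v∈ (trans (sym (colour-∈ᵇ u∈)) (trans same (colour-∈ᵇ v∈))))

    joined : ∀ i j → i ≢ j → ∃ λ u → ∃ λ v → branchOf u ≡ just i × branchOf v ≡ just j
                                          × adj G u v ≡ true × colour u ≡ colour v
    joined i j i≢j =
      let _ , x , y , x∈ , y∈ , y∈Nx , same = AllPairs-lookup compatible-sym compatible i≢j
      in x , y , branchOf-complete x∈ , branchOf-complete y∈ , ∈N⁻ y∈Nx ,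
         trans (colour-∈ᵇ x∈) (trans same (sym (colour-∈ᵇ y∈)))

    toOddExpansion : OddExpansion G t
    toOddExpansion = record
      { branch    = branchOf
      ; tree      = tree
      ; colour    = colour
      ; treeSym   = λ u v → does-⇔ (mk⇔ treeEdge-sym treeEdge-sym) (treeEdge? u v) (treeEdge? v u)
      ; treeAdj   = λ u v uv → let (_ , u∈ , v∈) , u≢v = tree⁻ uv in ∈N⁻ (∈ᵇ-adjacent u∈ v∈ u≢v)
      ; treeIn    = λ u v uv → let (i , u∈ , v∈) , _ = tree⁻ uv in
                               i , branchOf-complete u∈ , branchOf-complete v∈
      ; acyclic   = acyclic
      ; nonempty  = λ i → hub (B i) , branchOf-complete (hub∈ᵇ (B i))
      ; connected = connected
      ; bichrom   = bichromatic
      ; joined    = joined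
      }

module Greedy {n : ℕ} (G : Graph n) (δ≥n∸3 : MinDegreeAtLeast G (n ∸ 3)) (a : ℕ)
              (α-bound : ∀ S → Independent G S → ∣ S ∣ ≤ a) where

  open Adjacency G
  open CoDegree G δ≥n∸3
  open Branches G

  nonEdge⇒2≤α : ∀ {u v} → u ∉ N G v → u ≢ v → 2 ≤ a
  nonEdge⇒2≤α {u} {v} u∉Nv u≢v =
    ≤-trans (length≤∣p∣ ((u≢v ∷ []) ∷ [] ∷ []) (u∈ ∷ v∈ ∷ [])) (α-bound (⁅ u ⁆ ∪ ⁅ v ⁆) independent)
    where
    u∈ : u ∈ ⁅ u ⁆ ∪ ⁅ v ⁆
    u∈ = x∈p∪q⁺ (inj₁ (x∈⁅x⁆ u))
    v∈ : v ∈ ⁅ u ⁆ ∪ ⁅ v ⁆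
    v∈ = x∈p∪q⁺ (inj₂ (x∈⁅x⁆ v))
    pair : ∀ {x} → x ∈ ⁅ u ⁆ ∪ ⁅ v ⁆ → x ≡ u ⊎ x ≡ v
    pair x∈ = Sum.map (x∈⁅y⁆⇒x≡y u) (x∈⁅y⁆⇒x≡y v) (x∈p∪q⁻ ⁅ u ⁆ ⁅ v ⁆ x∈)
    independent : Independent G (⁅ u ⁆ ∪ ⁅ v ⁆)
    independent x y x∈ y∈ with pair x∈ | pair y∈
    ... | inj₁ refl | inj₁ refl = irrefl G u
    ... | inj₁ refl | inj₂ refl = ∉N⁻ (u∉Nv ∘ ∈N-sym)
    ... | inj₂ refl | inj₁ refl = ∉N⁻ u∉Nv
    ... | inj₂ refl | inj₂ refl = irrefl G v

  -- R is the set of vertices not used so far.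
  record Partial (R : Subset n) : Set where
    field
      branches   : List Branch
      compatible : AllPairs Compatible branches
      avoids     : All (Allᵇ (_∉ R)) branches
      dominated  : All (λ B → R ⊆ N G (hub B)) branches
      bound      : n ≤ a * length branches + ∣ R ∣

  record Step (R : Subset n) : Set where
    field
      R′         : Subset n
      branches   : List Branch
      compatible : AllPairs Compatible branches
      within     : All (Allᵇ (_∈ R)) branches
      avoids     : All (Allᵇ (_∉ R′)) branches
      dominated  : All (λ B → R′ ⊆ N G (hub B)) branches
      R′⊆R       : R′ ⊆ R
      shrinks    : ∣ R′ ∣ < ∣ R ∣
      bound      : ∣ R ∣ ≤ a * length branches + ∣ R′ ∣

  initial : Partial ⊤
  initial = record
    { branches = [] ; compatible = [] ; avoids = [] ; dominated = []
    ; bound = ≤-reflexive (sym (trans (cong (_+ ∣ ⊤ {n} ∣) (*-zeroʳ a)) (∣⊤∣≡n n)))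
    }

  new-old-compatible : ∀ {R B C} → Allᵇ (_∈ R) B → Allᵇ (_∉ R) C → R ⊆ N G (hub C) → Compatible B C
  new-old-compatible {R} {B} B⊆R C∉R R⊆NC =
    allᵇ-map (λ x∈R → allᵇ-map (λ y∉R x≡y → y∉R (subst (_∈ R) x≡y x∈R)) C∉R) B⊆R ,
    hubs-linked (∈N-sym (R⊆NC (allᵇ-∈ B⊆R (hub∈ᵇ B))))

  extend : ∀ {R} → Partial R → (s : Step R) → Partial (Step.R′ s)
  extend {R} P s = record
    { branches   = S.branches ++ P.branches
    ; compatible = AllPairs.++⁺ S.compatible P.compatible
                     (All.map (λ B⊆R → All.zipWith {Q = λ C → R ⊆ N G (hub C)}
                                                  (λ (C∉R , R⊆NC) → new-old-compatible B⊆R C∉R R⊆NC)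
                                                  (P.avoids , P.dominated))
                              S.within)
    ; avoids     = All.++⁺ S.avoids (All.map (allᵇ-map (_∘ S.R′⊆R)) P.avoids)
    ; dominated  = All.++⁺ S.dominated (All.map (⊆-trans S.R′⊆R) P.dominated)
    ; bound      = begin
        n                                 ≤⟨ P.bound ⟩
        a * old + ∣ R ∣                   ≤⟨ +-monoʳ-≤ (a * old) S.bound ⟩
        a * old + (a * new + ∣ S.R′ ∣)    ≡⟨ sym (+-assoc (a * old) (a * new) _) ⟩
        (a * old + a * new) + ∣ S.R′ ∣    ≡⟨ cong (_+ ∣ S.R′ ∣) (+-comm (a * old) (a * new)) ⟩
        (a * new + a * old) + ∣ S.R′ ∣    ≡⟨ cong (_+ ∣ S.R′ ∣) (sym (*-distribˡ-+ a new old)) ⟩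
        a * (new + old) + ∣ S.R′ ∣        ≡⟨ cong (λ k → a * k + ∣ S.R′ ∣) (sym (length-++ S.branches)) ⟩
        a * length (S.branches ++ P.branches) + ∣ S.R′ ∣ ∎
    }
    where
    module P = Partial P
    module S = Step s
    open ≤-Reasoning
    old new : ℕ
    old = length P.branches
    new = length S.branches

  singleStep : ∀ {R h} → h ∈ R → Independent G (R ∩ ∁ (N G h)) → Step R
  singleStep {R} {h} h∈R independent = record
    { R′         = R ∩ N G h
    ; branches   = vertex h ∷ []
    ; compatible = [] ∷ []
    ; within     = vertex h∈R ∷ []
    ; avoids     = vertex (x∉q⇒x∉p∩q self∉N) ∷ []
    ; dominated  = p∩q⊆q R (N G h) ∷ []
    ; R′⊆R       = p∩q⊆p R (N G h)
    ; shrinks    = p⊂q⇒∣p∣<∣q∣ (p∩q⊆p R (N G h) , h , h∈R , x∉q⇒x∉p∩q self∉N)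
    ; bound      = begin
        ∣ R ∣                             ≡⟨ ∣p∣≡∣p∩q∣+∣p∩∁q∣ R (N G h) ⟩
        ∣ R ∩ N G h ∣ + ∣ R ∩ ∁ (N G h) ∣ ≤⟨ +-monoʳ-≤ ∣ R ∩ N G h ∣ (α-bound _ independent) ⟩
        ∣ R ∩ N G h ∣ + a                 ≡⟨ +-comm ∣ R ∩ N G h ∣ a ⟩
        a + ∣ R ∩ N G h ∣                 ≡⟨ cong (_+ ∣ R ∩ N G h ∣) (sym (*-identityʳ a)) ⟩
        a * 1 + ∣ R ∩ N G h ∣             ∎
    }
    where open ≤-Reasoning

  pairStep : ∀ {R y} (B C : Branch) → Compatible B C → Allᵇ (_∈ R) B → Allᵇ (_∈ R) C
             → Allᵇ (_∉ (R ∩ N G (hub B)) ∩ N G (hub C)) B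
             → Allᵇ (_∉ (R ∩ N G (hub B)) ∩ N G (hub C)) C
             → (R ∩ N G (hub B)) ∩ ∁ (N G (hub C)) ⊆ ⁅ y ⁆ → 2 ≤ a → Step R
  pairStep {R} {y} B C compatible B⊆R C⊆R B∉R′ C∉R′ leftover⊆⁅y⁆ 2≤a = record
    { R′         = R′
    ; branches   = B ∷ C ∷ []
    ; compatible = (compatible ∷ []) ∷ [] ∷ []
    ; within     = B⊆R ∷ C⊆R ∷ []
    ; avoids     = B∉R′ ∷ C∉R′ ∷ []
    ; dominated  = ⊆-trans (p∩q⊆p Rp Nq) (p∩q⊆q R Np) ∷ p∩q⊆q Rp Nq ∷ []
    ; R′⊆R       = R′⊆R
    ; shrinks    = p⊂q⇒∣p∣<∣q∣ (R′⊆R , hub B , allᵇ-∈ B⊆R (hub∈ᵇ B) , allᵇ-∈ B∉R′ (hub∈ᵇ B))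
    ; bound      = begin
        ∣ R ∣                                   ≡⟨ ∣p∣≡∣p∩q∣+∣p∩∁q∣ R Np ⟩
        ∣ Rp ∣ + ∣ R ∩ ∁ Np ∣                    ≡⟨ cong (_+ ∣ R ∩ ∁ Np ∣) (∣p∣≡∣p∩q∣+∣p∩∁q∣ Rp Nq) ⟩
        (∣ R′ ∣ + ∣ Rp ∩ ∁ Nq ∣) + ∣ R ∩ ∁ Np ∣ ≤⟨ +-mono-≤ (+-monoʳ-≤ ∣ R′ ∣ leftover≤1) R∖Np≤3 ⟩
        (∣ R′ ∣ + 1) + 3                        ≡⟨ +-assoc ∣ R′ ∣ 1 3 ⟩
        ∣ R′ ∣ + 4                              ≤⟨ +-monoʳ-≤ ∣ R′ ∣ (*-monoˡ-≤ 2 2≤a) ⟩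
        ∣ R′ ∣ + a * 2                          ≡⟨ +-comm ∣ R′ ∣ (a * 2) ⟩
        a * 2 + ∣ R′ ∣                          ∎
    }
    where
    open ≤-Reasoning
    Np Nq Rp R′ : Subset n
    Np = N G (hub B)
    Nq = N G (hub C)
    Rp = R ∩ Np
    R′ = Rp ∩ Nq
    R′⊆R : R′ ⊆ R
    R′⊆R = ⊆-trans (p∩q⊆p Rp Nq) (p∩q⊆p R Np)
    leftover≤1 : ∣ Rp ∩ ∁ Nq ∣ ≤ 1
    leftover≤1 = ≤-trans (p⊆q⇒∣p∣≤∣q∣ leftover⊆⁅y⁆) (≤-reflexive (∣⁅x⁆∣≡1 y))
    R∖Np≤3 : ∣ R ∩ ∁ Np ∣ ≤ 3
    R∖Np≤3 = ≤-trans (∣p∩q∣≤∣q∣ R (∁ Np)) (∣∁N∣≤3 (hub B))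

  twoVertexStep : ∀ {R v u w x} → v ∈ R → x ∈ R → u ∉ N G v → w ∉ N G v → w ∈ N G u
               → x ∉ N G u → x ∈ N G v → w ∉ N G x → Step R
  twoVertexStep {R} {v} {u} {w} {x} v∈R x∈R u∉Nv w∉Nv w∈Nu x∉Nu x∈Nv w∉Nx =
    pairStep (vertex v) (vertex x)
      (vertex (vertex (∈N⇒≢ x∈Nv ∘ sym)) , hubs-linked x∈Nv)
      (vertex v∈R) (vertex x∈R)
      (vertex (x∉p⇒x∉p∩q (x∉q⇒x∉p∩q self∉N))) (vertex (x∉q⇒x∉p∩q self∉N))
      leftover (nonEdge⇒2≤α u∉Nv u≢v)
    where
    u≢v : u ≢ v
    u≢v refl = w∉Nv w∈Nu
    leftover : (R ∩ N G v) ∩ ∁ (N G x) ⊆ ⁅ x ⁆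
    leftover r∈ with x∈p∩∁q⁻ (R ∩ N G v) (N G x) r∈
    ... | r∈R∩Nv , r∉Nx with nonNeighbour-cases (x∉Nu ∘ ∈N-sym) w∉Nx w∈Nu r∉Nx
    ...   | inj₁ refl        = x∈⁅x⁆ x
    ...   | inj₂ (inj₁ refl) = ⊥-elim (u∉Nv (proj₂ (x∈p∩q⁻ R (N G v) r∈R∩Nv)))
    ...   | inj₂ (inj₂ refl) = ⊥-elim (w∉Nv (proj₂ (x∈p∩q⁻ R (N G v) r∈R∩Nv)))

  twoEdgeStep : ∀ {R v u w x} → v ∈ R → u ∈ R → w ∈ R → x ∈ R → u ∉ N G v → w ∉ N G v
               → w ∈ N G u → x ∉ N G u → x ∈ N G v → w ∈ N G x → Step R
  twoEdgeStep {R} {v} {u} {w} {x} v∈R u∈R w∈R x∈R u∉Nv w∉Nv w∈Nu x∉Nu x∈Nv w∈Nx =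
    pairStep (edge u w w∈Nu) (edge v x x∈Nv)
      (edge (edge u≢v u≢x) (edge w≢v w≢x) , leaves-linked w∈Nu x∈Nv (∈N-sym w∈Nx))
      (edge u∈R w∈R) (edge v∈R x∈R)
      (edge (x∉p⇒x∉p∩q (x∉q⇒x∉p∩q self∉N)) (x∉q⇒x∉p∩q w∉Nv))
      (edge (x∉q⇒x∉p∩q self∉N) (x∉p⇒x∉p∩q (x∉q⇒x∉p∩q x∉Nu)))
      leftover (nonEdge⇒2≤α u∉Nv u≢v)
    where
    u≢v : u ≢ v
    u≢v refl = w∉Nv w∈Nu
    u≢x : u ≢ x
    u≢x refl = u∉Nv x∈Nv
    w≢v : w ≢ v
    w≢v refl = u∉Nv (∈N-sym w∈Nu)
    w≢x : w ≢ x
    w≢x refl = x∉Nu w∈Nu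
    leftover : (R ∩ N G u) ∩ ∁ (N G v) ⊆ ⁅ w ⁆
    leftover r∈ with x∈p∩∁q⁻ (R ∩ N G u) (N G v) r∈
    ... | r∈R∩Nu , r∉Nv with nonNeighbour-cases u∉Nv w∉Nv w∈Nu r∉Nv
    ...   | inj₁ refl        = ⊥-elim (u∉Nv (∈N-sym (proj₂ (x∈p∩q⁻ R (N G u) r∈R∩Nu))))
    ...   | inj₂ (inj₁ refl) = ⊥-elim (self∉N (proj₂ (x∈p∩q⁻ R (N G u) r∈R∩Nu)))
    ...   | inj₂ (inj₂ refl) = x∈⁅x⁆ w

  -- The configurations are named after the paths their non-edges form in the complement
  -- of G: u v w in stepAtCoP₃, extended to w v u x in stepAtCoP₄.
  stepAtCoP₄ : ∀ {R v u w x} → v ∈ R → u ∈ R → w ∈ R → x ∈ R → u ∉ N G v → w ∉ N G v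
                → w ∈ N G u → x ∉ N G u → x ∈ N G v → Step R
  stepAtCoP₄ {w = w} {x} v∈R u∈R w∈R x∈R u∉Nv w∉Nv w∈Nu x∉Nu x∈Nv with w ∈? N G x
  ... | no w∉Nx  = twoVertexStep v∈R x∈R u∉Nv w∉Nv w∈Nu x∉Nu x∈Nv w∉Nx
  ... | yes w∈Nx = twoEdgeStep v∈R u∈R w∈R x∈R u∉Nv w∉Nv w∈Nu x∉Nu x∈Nv w∈Nx

  stepAtCoP₃ : ∀ {R v u w} → v ∈ R → u ∈ R → w ∈ R → u ∉ N G v → w ∉ N G v → w ∈ N G u → Step R
  stepAtCoP₃ {R} {v} {u} {w} v∈R u∈R w∈R u∉Nv w∉Nv w∈Nu with independent-or-edge (R ∩ ∁ (N G u))
  ... | inj₁ independent = singleStep u∈R independent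
  ... | inj₂ (y , z , y∈ , z∈ , z∈Ny)
      with x∈p∩∁q⁻ R (N G u) y∈ | x∈p∩∁q⁻ R (N G u) z∈
  ... | y∈R , y∉Nu | z∈R , z∉Nu with nonNeighbour-cases y∉Nu z∉Nu z∈Ny (u∉Nv ∘ ∈N-sym)
  ...   | inj₁ refl        = ⊥-elim (w∉Nv w∈Nu)
  ...   | inj₂ (inj₁ refl) = stepAtCoP₄ v∈R u∈R w∈R z∈R u∉Nv w∉Nv w∈Nu z∉Nu z∈Ny
  ...   | inj₂ (inj₂ refl) = stepAtCoP₄ v∈R u∈R w∈R y∈R u∉Nv w∉Nv w∈Nu y∉Nu (∈N-sym z∈Ny)

  stepAt : ∀ {R v} → v ∈ R → Step R
  stepAt {R} {v} v∈R with independent-or-edge (R ∩ ∁ (N G v))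
  ... | inj₁ independent = singleStep v∈R independent
  ... | inj₂ (u , w , u∈ , w∈ , w∈Nu) =
    let u∈R , u∉Nv = x∈p∩∁q⁻ R (N G v) u∈
        w∈R , w∉Nv = x∈p∩∁q⁻ R (N G v) w∈
    in stepAtCoP₃ v∈R u∈R w∈R u∉Nv w∉Nv w∈Nu

  grow : ∀ {R} → Acc (_<_ on ∣_∣) R → Partial R → ∃ λ t → n ≤ a * t × OddExpansion G t
  grow {R} (acc smaller) partial with nonempty? R
  ... | yes (v , v∈R) = grow (smaller (Step.shrinks s)) (extend partial s)
    where
    s : Step R
    s = stepAt v∈R
  ... | no R-empty = length branches , n≤a*t , toOddExpansion branches compatible
    where
    open Partial partial
    ∣R∣≡0 : ∣ R ∣ ≡ 0
    ∣R∣≡0 = trans (cong ∣_∣ (Empty-unique R-empty)) (∣⊥∣≡0 n)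
    n≤a*t : n ≤ a * length branches
    n≤a*t = subst (n ≤_) (trans (cong (a * length branches +_) ∣R∣≡0) (+-identityʳ _)) bound

  expansion : ∃ λ t → n ≤ a * t × OddExpansion G t
  expansion = grow (On.wellFounded ∣_∣ <-wellFounded ⊤) initial

ceilDiv-least : ∀ {n a t} → n ≤ a * t → ceilDiv n a ≤ t
ceilDiv-least {a = zero}          _      = z≤n
ceilDiv-least {n} {suc k} {t} n≤a*t = s≤s⁻¹ (m<n*o⇒m/o<n {n + k} {suc t} {suc k} (s≤s n+k≤k+t*a))
  where
  open ≤-Reasoning
  n+k≤k+t*a : n + k ≤ k + t * suc k
  n+k≤k+t*a = begin
    n + k          ≡⟨ +-comm n k ⟩
    k + n          ≤⟨ +-monoʳ-≤ k n≤a*t ⟩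
    k + suc k * t  ≡⟨ cong (k +_) (*-comm (suc k) t) ⟩
    k + t * suc k  ∎

lemma1p12 : (n : ℕ) → 1 ≤ n → (G : Graph n) → MinDegreeAtLeast G (n ∸ 3)
    → (a : ℕ) → IsIndependenceNumber G a → OhAtLeast G (ceilDiv n a)
lemma1p12 n _ G δ≥n∸3 a (_ , α-bound) =
  let t , n≤a*t , E = Greedy.expansion G δ≥n∸3 a α-bound
  in t , ceilDiv-least {a = a} n≤a*t , E
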